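{- The Baxter monoid satisfies the identity $xyxyxy = xyyxxy$; that is, for all $x,y \in \mathcal{A}^*$, $xyxyxy \equiv_{\mathrm{baxt}} xyyxxy$.
   Context: $\mathcal{A} = \{1,2,3,\ldots\}$ with the usual order; $\mathcal{A}^*$ the free monoid over $\mathcal{A}$. $\mathrm{rtree}(a_1\cdots a_k)$ is the right strict binary search tree obtained from the empty tree by inserting $a_k,\ldots,a_1$ in turn, where inserting $a$ creates a node at an empty position and otherwise recurses into the left subtree if $a \le$ root label, into the right subtree otherwise. $\mathrm{ltree}(a_1\cdots a_k)$ is the left strict binary search tree obtained from the empty tree by inserting $a_1,\ldots,a_k$ in turn, where inserting $a$ recurses into the right subtree if $a \ge$ root label and into the left subtree otherwise. The Baxter congruence: $u \equiv_{\mathrm{baxt}} v$ iff $\mathrm{ltree}(u)=\mathrm{ltree}(v)$ and $\mathrm{rtree}(u)=\mathrm{rtree}(v)$; the Baxter monoid is $\mathcal{A}^*/{\equiv_{\mathrm{baxt}}}$. -}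

module Defs where

open import Data.Nat using (ℕ; _≤_; _≤?_)
open import Data.List using (List; []; _∷_; _++_; foldl; foldr)
open import Data.Product using (_×_)
open import Relation.Nullary using (yes; no)
open import Relation.Binary.PropositionalEquality using (_≡_)

-- We encode the letter
-- k ≥ 1 by the natural number k - 1; this is an order isomorphism
-- ℕ ≅ {1,2,3,...}, and all constructions below only use the order.
Letter : Set
Letter = ℕ

Word : Set
Word = List Letter

data Tree : Set where
  leaf : Tree
  node : Tree → Letter → Tree → Tree

rinsert : Letter → Tree → Tree
rinsert a leaf = node leaf a leaf
rinsert a (node l b r) with a ≤? b
... | yes _ = node (rinsert a l) b r
... | no  _ = node l b (rinsert a r)

linsert : Letter → Tree → Tree
linsert a leaf = node leaf a leaf
linsert a (node l b r) with b ≤? a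
... | yes _ = node l b (linsert a r)
... | no  _ = node (linsert a l) b r

rtree : Word → Tree
rtree = foldr rinsert leaf

ltree : Word → Tree
ltree = foldl (λ t a → linsert a t) leaf

_≡baxt_ : Word → Word → Set
u ≡baxt v = (ltree u ≡ ltree v) × (rtree u ≡ rtree v)

-- Let ≼ be a decidable partial order and T a tree obtained by left strict insertion of a
-- word w.  Reinserting a letter c of w, its search path ends at the leaf directly right of
-- a node labelled c, and inserting new letters keeps this true.  Hence inserting a word u
-- whose letters occur in w sends a constant word to every leaf, so the result depends only
-- on the multiset of u: ltree (w u) = ltree (w v) whenever u ↭ v.  Taking w = xy and
-- u = xyxy ↭ yxxy gives the ltree half.  Since rtree of a word is the mirror image of the
-- left strict tree, for the reversed order, of the reversed word, the same fact gives
-- rtree (u w) = rtree (v w), and u = xyxy ↭ xyyx gives the rtree half.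
module Submission where

open import Defs
open import Data.List using (List; []; _∷_; _++_; foldl; filter; length; reverse)
open import Data.List.Properties using (++-assoc; foldl-++; foldl-∷ʳ; foldl-cong; unfold-reverse; reverse-++)
open import Data.List.Relation.Unary.All as All using (All; []; _∷_)
open import Data.List.Relation.Unary.All.Properties using (all-filter; filter⁺)
open import Data.List.Membership.Propositional using (_∈_)
open import Data.List.Membership.Propositional.Properties using (∈-++⁻)
open import Data.List.Relation.Unary.Any.Properties using (reverse⁺; reverse⁻)
open import Data.List.Relation.Binary.Subset.Propositional using (_⊆_)
open import Data.List.Relation.Binary.Subset.Propositional.Properties using (⊆-reflexive)
open import Data.List.Relation.Binary.Permutation.Propositional using (_↭_; ↭-trans; ↭-sym)
open import Data.List.Relation.Binary.Permutation.Propositional.Properties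
  using (All-resp-↭; ↭-length; filter-↭; ↭-reverse; shifts; ++⁺ˡ; ++-comm)
open import Data.List.Relation.Unary.Any using (here; there)
open import Data.Maybe using (Maybe; just; nothing)
import Data.Maybe.Relation.Unary.All as Maybe
open import Data.Nat using (pred; _≤?_)
open import Data.Nat.Properties using (≤-refl; ≤-antisym; _≥?_)
open import Data.Product using (_×_; _,_)
open import Data.Sum using ([_,_]′)
open import Function using (id; _∘_; flip)
open import Level using (Level)
open import Relation.Binary using (Rel; Decidable; Reflexive; Antisymmetric)
open import Relation.Nullary using (¬_; yes; no; contradiction)
open import Relation.Nullary.Decidable using (¬?)
open import Relation.Binary.PropositionalEquality

all-subsingleton-≡ : ∀ {a p} {A : Set a} {P : A → Set p} → (∀ {a b} → P a → P b → a ≡ b) →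
                     ∀ {u v} → All P u → All P v → length u ≡ length v → u ≡ v
all-subsingleton-≡ unique [] [] _ = refl
all-subsingleton-≡ unique (pa ∷ pu) (pb ∷ pv) eq =
  cong₂ _∷_ (unique pa pb) (all-subsingleton-≡ unique pu pv (cong pred eq))

↭-subsingleton-≡ : ∀ {a p} {A : Set a} {P : A → Set p} → (∀ {a b} → P a → P b → a ≡ b) →
                   ∀ {u v} → u ↭ v → All P u → u ≡ v
↭-subsingleton-≡ unique u↭v pu = all-subsingleton-≡ unique pu (All-resp-↭ u↭v pu) (↭-length u↭v)

++-idem-⊆ : ∀ {a} {A : Set a} (w : List A) → w ++ w ⊆ w
++-idem-⊆ w = [ id , id ]′ ∘ ∈-++⁻ w

++-assoc⁴ : ∀ {a} {A : Set a} (x y z u v : List A) → (x ++ y ++ z ++ u) ++ v ≡ x ++ y ++ z ++ u ++ v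
++-assoc⁴ x y z u v = begin
  (x ++ y ++ z ++ u) ++ v   ≡⟨ ++-assoc x (y ++ z ++ u) v ⟩
  x ++ (y ++ z ++ u) ++ v   ≡⟨ cong (x ++_) (++-assoc y (z ++ u) v) ⟩
  x ++ y ++ (z ++ u) ++ v   ≡⟨ cong (λ w → x ++ y ++ w) (++-assoc z u v) ⟩
  x ++ y ++ z ++ u ++ v     ∎
  where open ≡-Reasoning

module Insertion {ℓ : Level} {_≼_ : Rel Letter ℓ} (_≼?_ : Decidable _≼_)
                 (≼-refl : Reflexive _≼_) (≼-antisym : Antisymmetric _≡_ _≼_) where

  insert : Letter → Tree → Tree
  insert a leaf = node leaf a leaf
  insert a (node l b r) with b ≼? a
  ... | yes _ = node l b (insert a r)
  ... | no  _ = node (insert a l) b r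

  insertAll : Word → Tree → Tree
  insertAll w t = foldl (λ t a → insert a t) t w

  goesLeft goesRight : Letter → Word → Word
  goesLeft  b = filter (¬? ∘ (b ≼?_))
  goesRight b = filter (b ≼?_)

  insertAll-node : ∀ w l b r →
    insertAll w (node l b r) ≡ node (insertAll (goesLeft b w) l) b (insertAll (goesRight b w) r)
  insertAll-node []      l b r = refl
  insertAll-node (a ∷ w) l b r with b ≼? a
  ... | yes _ = insertAll-node w l b (insert a r)
  ... | no  _ = insertAll-node w (insert a l) b r

  -- Lands lo T c: the search path of c in T ends at a leaf whose in-order predecessor
  -- is labelled c; lo is the label of the last right turn taken above T.
  data Lands : Maybe Letter → Tree → Letter → Set ℓ where
    leaf  : ∀ {c} → Lands (just c) leaf c
    right : ∀ {lo l b r c} → b ≼ c → Lands (just b) r c → Lands lo (node l b r) c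
    left  : ∀ {lo l b r c} → ¬ b ≼ c → Lands lo l c → Lands lo (node l b r) c

  lands-leaf-unique : ∀ {lo a b} → Lands lo leaf a → Lands lo leaf b → a ≡ b
  lands-leaf-unique leaf leaf = refl

  lands-goesLeft : ∀ {lo l b r} w → All (Lands lo (node l b r)) w → All (Lands lo l) (goesLeft b w)
  lands-goesLeft {b = b} w lw = All.zipWith from-left (filter⁺ (¬? ∘ (b ≼?_)) lw , all-filter (¬? ∘ (b ≼?_)) w)
    where
    from-left : ∀ {lo l b r c} → Lands lo (node l b r) c × ¬ b ≼ c → Lands lo l c
    from-left (right b≼c _ , b⋠c) = contradiction b≼c b⋠c
    from-left (left _ lc , _) = lc

  lands-goesRight : ∀ {lo l b r} w → All (Lands lo (node l b r)) w → All (Lands (just b) r) (goesRight b w)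
  lands-goesRight {b = b} w lw = All.zipWith from-right (filter⁺ (b ≼?_) lw , all-filter (b ≼?_) w)
    where
    from-right : ∀ {lo l b r c} → Lands lo (node l b r) c × b ≼ c → Lands (just b) r c
    from-right (right _ rc , _) = rc
    from-right (left b⋠c _ , b≼c) = contradiction b≼c b⋠c

  lands-inserted : ∀ lo t a → Lands lo (insert a t) a
  lands-inserted lo leaf a = right ≼-refl leaf
  lands-inserted lo (node l b r) a with b ≼? a
  ... | yes b≼a = right b≼a (lands-inserted (just b) r a)
  ... | no  b⋠a = left b⋠a (lands-inserted lo l a)

  lands-insert : ∀ {lo t c} a → Maybe.All (_≼ a) lo → Lands lo t c → Lands lo (insert a t) c
  lands-insert {c = c} a (Maybe.just c≼a) leaf with a ≼? c
  ... | yes a≼c rewrite ≼-antisym a≼c c≼a = right ≼-refl leaf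
  ... | no  a⋠c = left a⋠c leaf
  lands-insert a lo≼a (right {b = b} b≼c rc) with b ≼? a
  ... | yes b≼a = right b≼c (lands-insert a (Maybe.just b≼a) rc)
  ... | no  _   = right b≼c rc
  lands-insert a lo≼a (left {b = b} b⋠c lc) with b ≼? a
  ... | yes _ = left b⋠c lc
  ... | no  _ = left b⋠c (lands-insert a lo≼a lc)

  lands-insertAll : ∀ {t c} w → Lands nothing t c → Lands nothing (insertAll w t) c
  lands-insertAll []      lc = lc
  lands-insertAll (a ∷ w) lc = lands-insertAll w (lands-insert a Maybe.nothing lc)

  lands-insertAll-∈ : ∀ {c} t w → c ∈ w → Lands nothing (insertAll w t) c
  lands-insertAll-∈ t (a ∷ w) (here refl) = lands-insertAll w (lands-inserted nothing t a)
  lands-insertAll-∈ t (a ∷ w) (there c∈w) = lands-insertAll-∈ (insert a t) w c∈w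

  -- All letters reaching a leaf equal its lower bound, so each leaf receives a constant
  -- word, which is determined by its length alone.
  insertAll-cong-↭ : ∀ {lo u v} t → u ↭ v → All (Lands lo t) u → insertAll u t ≡ insertAll v t
  insertAll-cong-↭ leaf u↭v lu = cong (λ w → insertAll w leaf) (↭-subsingleton-≡ lands-leaf-unique u↭v lu)
  insertAll-cong-↭ {u = u} {v} (node l b r) u↭v lu = begin
    insertAll u (node l b r)
      ≡⟨ insertAll-node u l b r ⟩
    node (insertAll (goesLeft b u) l) b (insertAll (goesRight b u) r)
      ≡⟨ cong₂ (λ l′ r′ → node l′ b r′)
           (insertAll-cong-↭ l (filter-↭ _ u↭v) (lands-goesLeft u lu))
           (insertAll-cong-↭ r (filter-↭ _ u↭v) (lands-goesRight u lu)) ⟩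
    node (insertAll (goesLeft b v) l) b (insertAll (goesRight b v) r)
      ≡⟨ insertAll-node v l b r ⟨
    insertAll v (node l b r) ∎
    where open ≡-Reasoning

  insertAll-++-cong-↭ : ∀ t w {u v} → u ↭ v → u ⊆ w → insertAll (w ++ u) t ≡ insertAll (w ++ v) t
  insertAll-++-cong-↭ t w {u} {v} u↭v u⊆w = begin
    insertAll (w ++ u) t    ≡⟨ foldl-++ _ t w u ⟩
    insertAll u (insertAll w t)
      ≡⟨ insertAll-cong-↭ _ u↭v (All.tabulate (lands-insertAll-∈ t w ∘ u⊆w)) ⟩
    insertAll v (insertAll w t) ≡⟨ foldl-++ _ t w v ⟨
    insertAll (w ++ v) t    ∎
    where open ≡-Reasoning

module Left  = Insertion _≤?_ ≤-refl ≤-antisym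
module Right = Insertion _≥?_ ≤-refl (flip ≤-antisym)

linsert≡insert : ∀ a t → linsert a t ≡ Left.insert a t
linsert≡insert a leaf = refl
linsert≡insert a (node l b r) with b ≤? a
... | yes _ = cong (node l b) (linsert≡insert a r)
... | no  _ = cong (λ l′ → node l′ b r) (linsert≡insert a l)

ltree≡insertAll : ∀ w → ltree w ≡ Left.insertAll w leaf
ltree≡insertAll = foldl-cong (flip linsert≡insert) leaf

mirror : Tree → Tree
mirror leaf = leaf
mirror (node l b r) = node (mirror r) b (mirror l)

rinsert-mirror : ∀ a t → rinsert a (mirror t) ≡ mirror (Right.insert a t)
rinsert-mirror a leaf = refl
rinsert-mirror a (node l b r) with a ≤? b
... | yes _ = cong (λ r′ → node r′ b (mirror l)) (rinsert-mirror a r)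
... | no  _ = cong (node (mirror r) b) (rinsert-mirror a l)

rtree≡mirror-insertAll : ∀ w → rtree w ≡ mirror (Right.insertAll (reverse w) leaf)
rtree≡mirror-insertAll []      = refl
rtree≡mirror-insertAll (a ∷ w) = begin
  rinsert a (rtree w)                                   ≡⟨ cong (rinsert a) (rtree≡mirror-insertAll w) ⟩
  rinsert a (mirror (Right.insertAll (reverse w) leaf)) ≡⟨ rinsert-mirror a (Right.insertAll (reverse w) leaf) ⟩
  mirror (Right.insert a (Right.insertAll (reverse w) leaf))
    ≡⟨ cong mirror (foldl-∷ʳ _ leaf a (reverse w)) ⟨
  mirror (Right.insertAll (reverse w ++ a ∷ []) leaf)   ≡⟨ cong (λ z → mirror (Right.insertAll z leaf)) (unfold-reverse a w) ⟨
  mirror (Right.insertAll (reverse (a ∷ w)) leaf)       ∎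
  where open ≡-Reasoning

ltree-++-cong-↭ : ∀ w {u v} → u ↭ v → u ⊆ w → ltree (w ++ u) ≡ ltree (w ++ v)
ltree-++-cong-↭ w {u} {v} u↭v u⊆w = begin
  ltree (w ++ u)                 ≡⟨ ltree≡insertAll (w ++ u) ⟩
  Left.insertAll (w ++ u) leaf   ≡⟨ Left.insertAll-++-cong-↭ leaf w u↭v u⊆w ⟩
  Left.insertAll (w ++ v) leaf   ≡⟨ ltree≡insertAll (w ++ v) ⟨
  ltree (w ++ v)                 ∎
  where open ≡-Reasoning

rtree-++-cong-↭ : ∀ w {u v} → u ↭ v → u ⊆ w → rtree (u ++ w) ≡ rtree (v ++ w)
rtree-++-cong-↭ w {u} {v} u↭v u⊆w = begin
  rtree (u ++ w)                                               ≡⟨ rtree≡mirror-insertAll (u ++ w) ⟩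
  mirror (Right.insertAll (reverse (u ++ w)) leaf)             ≡⟨ cong (λ z → mirror (Right.insertAll z leaf)) (reverse-++ u w) ⟩
  mirror (Right.insertAll (reverse w ++ reverse u) leaf)
    ≡⟨ cong mirror (Right.insertAll-++-cong-↭ leaf (reverse w) reverse-↭ (reverse⁺ ∘ u⊆w ∘ reverse⁻)) ⟩
  mirror (Right.insertAll (reverse w ++ reverse v) leaf)       ≡⟨ cong (λ z → mirror (Right.insertAll z leaf)) (reverse-++ v w) ⟨
  mirror (Right.insertAll (reverse (v ++ w)) leaf)             ≡⟨ rtree≡mirror-insertAll (v ++ w) ⟨
  rtree (v ++ w)                                               ∎
  where
  open ≡-Reasoning
  reverse-↭ : reverse u ↭ reverse v
  reverse-↭ = ↭-trans (↭-reverse u) (↭-trans u↭v (↭-sym (↭-reverse v)))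

theorem6 : (x y : Word) → (x ++ y ++ x ++ y ++ x ++ y) ≡baxt (x ++ y ++ y ++ x ++ x ++ y)
theorem6 x y = ltree-equal , rtree-equal
  where
  open ≡-Reasoning
  xyxy⊆xy : x ++ y ++ x ++ y ⊆ x ++ y
  xyxy⊆xy = ++-idem-⊆ (x ++ y) ∘ ⊆-reflexive (sym (++-assoc x y (x ++ y)))

  ltree-equal : ltree (x ++ y ++ x ++ y ++ x ++ y) ≡ ltree (x ++ y ++ y ++ x ++ x ++ y)
  ltree-equal = begin
    ltree (x ++ y ++ x ++ y ++ x ++ y)   ≡⟨ cong ltree (++-assoc x y _) ⟨
    ltree ((x ++ y) ++ x ++ y ++ x ++ y) ≡⟨ ltree-++-cong-↭ (x ++ y) (shifts x y) xyxy⊆xy ⟩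
    ltree ((x ++ y) ++ y ++ x ++ x ++ y) ≡⟨ cong ltree (++-assoc x y _) ⟩
    ltree (x ++ y ++ y ++ x ++ x ++ y)   ∎

  rtree-equal : rtree (x ++ y ++ x ++ y ++ x ++ y) ≡ rtree (x ++ y ++ y ++ x ++ x ++ y)
  rtree-equal = begin
    rtree (x ++ y ++ x ++ y ++ x ++ y)   ≡⟨ cong rtree (++-assoc⁴ x y x y (x ++ y)) ⟨
    rtree ((x ++ y ++ x ++ y) ++ x ++ y) ≡⟨ rtree-++-cong-↭ (x ++ y) (++⁺ˡ x (++⁺ˡ y (++-comm x y))) xyxy⊆xy ⟩
    rtree ((x ++ y ++ y ++ x) ++ x ++ y) ≡⟨ cong rtree (++-assoc⁴ x y y x (x ++ y)) ⟩
    rtree (x ++ y ++ y ++ x ++ x ++ y)   ∎
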